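{- Let $\alpha(k)$ be the largest odd divisor of $k$ and $G(n)=\sum_{k=1}^n\frac{n+1-k}{k}\alpha(k)$. Then $$\left\{n\ge1: G(n)=\frac{n(n+2)}{3}\right\}=\{2^r-1: r\ge1\}.$$
   Context: $\alpha(k)$ is the largest odd divisor of the positive integer $k$. -}

module Defs where

open import Data.Nat as ℕ using (ℕ; zero; suc; _∸_)
open import Data.Nat.DivMod using (_/_; _%_)
open import Data.Integer using (+_)
open import Data.Rational as ℚ using (ℚ; 0ℚ)

-- Odd part of k: repeatedly divide by 2 while even (fuel-bounded; fuel k suffices).
oddPart : ℕ → ℕ → ℕ
oddPart zero    k = k
oddPart (suc f) zero = zero
oddPart (suc f) (suc k) with suc k % 2
... | zero  = oddPart f (suc k / 2)
... | suc _ = suc k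

α : ℕ → ℕ
α k = oddPart k k

-- the summand (n+1-k)/k · α(k), for k ≥ 1 (written with k = suc j)
term : ℕ → ℕ → ℚ
term n j = ((+ ((suc n ∸ suc j) ℕ.* α (suc j))) ℚ./ suc j)

sumTo : ℕ → ℕ → ℚ
sumTo n zero    = 0ℚ
sumTo n (suc m) = sumTo n m ℚ.+ term n m

G : ℕ → ℚ
G n = sumTo n n

{-# OPTIONS --safe #-}

-- Put S(m) = Σ_{k≤m} α(k)/k, so that G(n) = Σ_{m≤n} S(m). An odd k contributes α(k)/k = 1 and an
-- even k = 2j contributes α(j)/(2j), hence S(2m) = m + S(m)/2 and S(2m+1) = S(2m) + 1. Consequently
-- U(m) = 3S(m) − 2m satisfies U(2m) = U(m)/2 and U(2m+1) = 1 + U(m)/2, so U(m) > 0 for m ≥ 1.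
-- The defect T(n) = 3G(n) − n(n+2) equals Σ_{m≤n} (U(m) − 1), and since U(2m) + U(2m+1) − 2 = U(m) − 1,
-- T(2n+1) = T(n) and T(2n+2) = T(n+1) − U(n+1)/2 < T(n+1). By binary induction T ≤ 0, with equality
-- exactly when every step is odd, i.e. when n = 2^r − 1.

module Submission where

open import Defs
open import Data.Nat using (ℕ; zero; suc; _≤_; _<_; _^_; _∸_; _*_; _+_; _%_; z≤n; s≤s; s≤s⁻¹; z<s)
open import Data.Nat.Properties
  using ( ≤-refl; ≤-trans; m≤m+n; m≤m*n; m<m+n; *-comm; *-suc; +-suc; *-identityˡ
        ; +-∸-assoc; m+n∸n≡m; <⇒≤; <⇒≢; m^n>0)
open import Data.Nat.DivMod using (m/n<m; [m+kn]%n≡m%n; m*n%n≡0; m*n/n≡m) renaming (_/_ to _div_)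
open import Data.Nat.Induction using (<-rec)
open import Data.Integer using (+_)
import Data.Integer as ℤ
import Data.Integer.Properties as ℤ
open import Data.Rational using (ℚ; _/_; 0ℚ; 1ℚ; ½; toℚᵘ; fromℚᵘ)
import Data.Rational as ℚ
import Data.Rational.Properties as ℚ
open import Data.Rational.Properties
  using (toℚᵘ-injective; toℚᵘ-fromℚᵘ; toℚᵘ-homo-+; toℚᵘ-homo-*; fromℚᵘ-cong)
open import Data.Rational.Solver using (module +-*-Solver)
open import Data.Rational.Unnormalised using (mkℚᵘ)
import Data.Rational.Unnormalised as ℚᵘ
import Data.Rational.Unnormalised.Properties as ℚᵘ
open import Data.Product using (Σ; _×_; _,_)
open import Data.Empty using (⊥-elim)
open import Relation.Binary.PropositionalEquality using (_≡_; refl; sym; trans; cong; cong₂; subst; module ≡-Reasoning)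
open import Function.Bundles using (_⇔_; mk⇔; Equivalence)

oddPart-zero : ∀ f → oddPart f 0 ≡ 0
oddPart-zero zero    = refl
oddPart-zero (suc f) = refl

oddPart-fuel : ∀ f g k → k ≤ f → k ≤ g → oddPart f k ≡ oddPart g k
oddPart-fuel f g zero _ _ = trans (oddPart-zero f) (sym (oddPart-zero g))
oddPart-fuel (suc f) (suc g) (suc k) (s≤s k≤f) (s≤s k≤g) with suc k % 2
... | zero  = oddPart-fuel f g (suc k div 2) (≤-trans half≤k k≤f) (≤-trans half≤k k≤g)
  where
  half≤k : suc k div 2 ≤ k
  half≤k = s≤s⁻¹ (m/n<m (suc k) 2 (s≤s (s≤s z≤n)))
... | suc _ = refl

oddPart-even : ∀ f k → suc k % 2 ≡ 0 → oddPart (suc f) (suc k) ≡ oddPart f (suc k div 2)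
oddPart-even f k _ with suc k % 2
... | zero = refl

oddPart-odd : ∀ f k → suc k % 2 ≡ 1 → oddPart (suc f) (suc k) ≡ suc k
oddPart-odd f k _ with suc k % 2
... | suc _ = refl

α-odd : ∀ m → α (suc (2 * m)) ≡ suc (2 * m)
α-odd m = oddPart-odd (2 * m) (2 * m) (trans (cong (λ x → suc x % 2) (*-comm 2 m)) ([m+kn]%n≡m%n 1 m 2))

α-double : ∀ m → α (2 * suc m) ≡ α (suc m)
α-double m = begin
  oddPart (2 * suc m) (2 * suc m)           ≡⟨ cong (λ x → oddPart x x) (*-comm 2 (suc m)) ⟩
  oddPart (suc m * 2) (suc m * 2)           ≡⟨ oddPart-even (suc (m * 2)) (suc (m * 2)) (m*n%n≡0 (suc m) 2) ⟩
  oddPart (suc (m * 2)) (suc m * 2 div 2)   ≡⟨ cong (oddPart (suc (m * 2))) (m*n/n≡m (suc m) 2) ⟩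
  oddPart (suc (m * 2)) (suc m)             ≡⟨ oddPart-fuel (suc (m * 2)) (suc m) (suc m) (s≤s (m≤m*n m 2)) ≤-refl ⟩
  oddPart (suc m) (suc m)                   ∎
  where open ≡-Reasoning

data Parity : ℕ → Set where
  even : ∀ k → Parity (2 * k)
  odd  : ∀ k → Parity (suc (2 * k))

parity : ∀ n → Parity n
parity zero = even 0
parity (suc n) with parity n
... | even k = odd k
... | odd k  = subst Parity (*-suc 2 k) (even (suc k))

binary-induction : ∀ {ℓ} (P : ℕ → Set ℓ) → P 0 →
                   (∀ k → P k → P (suc (2 * k))) →
                   (∀ k → P (suc k) → P (2 * suc k)) →
                   ∀ n → P n
binary-induction P P0 P-odd P-even = <-rec P step
  where
  step : ∀ n → (∀ {m} → m < n → P m) → P n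
  step n rec with parity n
  ... | even zero    = P0
  ... | even (suc k) = P-even k (rec (m<m+n (suc k) z<s))
  ... | odd k        = P-odd k (rec (s≤s (m≤m+n k (k + 0))))

Mersenne : ℕ → Set
Mersenne n = Σ ℕ (λ r → n ≡ 2 ^ r ∸ 1)

2^r∸1-suc : ∀ r → 2 ^ suc r ∸ 1 ≡ suc (2 * (2 ^ r ∸ 1))
2^r∸1-suc r = double∸1 (2 ^ r) (m^n>0 2 r)
  where
  double∸1 : ∀ x → 1 ≤ x → 2 * x ∸ 1 ≡ suc (2 * (x ∸ 1))
  double∸1 (suc y) _ = +-suc y (y + 0)

fromℚᵘ-homo-+ : ∀ p q → fromℚᵘ (p ℚᵘ.+ q) ≡ fromℚᵘ p ℚ.+ fromℚᵘ q
fromℚᵘ-homo-+ p q = toℚᵘ-injective (begin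
  toℚᵘ (fromℚᵘ (p ℚᵘ.+ q))              ≈⟨ toℚᵘ-fromℚᵘ (p ℚᵘ.+ q) ⟩
  p ℚᵘ.+ q                              ≈⟨ ℚᵘ.+-cong (toℚᵘ-fromℚᵘ p) (toℚᵘ-fromℚᵘ q) ⟨
  toℚᵘ (fromℚᵘ p) ℚᵘ.+ toℚᵘ (fromℚᵘ q)  ≈⟨ toℚᵘ-homo-+ (fromℚᵘ p) (fromℚᵘ q) ⟨
  toℚᵘ (fromℚᵘ p ℚ.+ fromℚᵘ q)          ∎)
  where open ℚᵘ.≃-Reasoning

fromℚᵘ-homo-* : ∀ p q → fromℚᵘ (p ℚᵘ.* q) ≡ fromℚᵘ p ℚ.* fromℚᵘ q
fromℚᵘ-homo-* p q = toℚᵘ-injective (begin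
  toℚᵘ (fromℚᵘ (p ℚᵘ.* q))              ≈⟨ toℚᵘ-fromℚᵘ (p ℚᵘ.* q) ⟩
  p ℚᵘ.* q                              ≈⟨ ℚᵘ.*-cong (toℚᵘ-fromℚᵘ p) (toℚᵘ-fromℚᵘ q) ⟨
  toℚᵘ (fromℚᵘ p) ℚᵘ.* toℚᵘ (fromℚᵘ q)  ≈⟨ toℚᵘ-homo-* (fromℚᵘ p) (fromℚᵘ q) ⟨
  toℚᵘ (fromℚᵘ p ℚ.* fromℚᵘ q)          ∎)
  where open ℚᵘ.≃-Reasoning

/-distribʳ-+ : ∀ a b d → + (a + b) / suc d ≡ + a / suc d ℚ.+ + b / suc d
/-distribʳ-+ a b d = begin
  + (a + b) / suc d
    ≡⟨ fromℚᵘ-cong (ℚᵘ.*-cancelʳ-/ (suc d) {+ (a + b)} {suc d}) ⟨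
  fromℚᵘ ((+ (a + b) ℤ.* + suc d) ℚᵘ./ (suc d * suc d))
    ≡⟨ cong (λ i → fromℚᵘ (i ℚᵘ./ (suc d * suc d))) (ℤ.*-distribʳ-+ (+ suc d) (+ a) (+ b)) ⟩
  fromℚᵘ (mkℚᵘ (+ a) d ℚᵘ.+ mkℚᵘ (+ b) d)
    ≡⟨ fromℚᵘ-homo-+ (mkℚᵘ (+ a) d) (mkℚᵘ (+ b) d) ⟩
  + a / suc d ℚ.+ + b / suc d
    ∎
  where open ≡-Reasoning

/-*-interchange : ∀ a b m n → (+ a / suc m) ℚ.* (+ b / suc n) ≡ + (a * b) / (suc m * suc n)
/-*-interchange a b m n = begin
  (+ a / suc m) ℚ.* (+ b / suc n)              ≡⟨ fromℚᵘ-homo-* (mkℚᵘ (+ a) m) (mkℚᵘ (+ b) n) ⟨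
  fromℚᵘ ((+ a ℤ.* + b) ℚᵘ./ (suc m * suc n))  ≡⟨ cong (λ i → fromℚᵘ (i ℚᵘ./ (suc m * suc n))) (ℤ.pos-* a b) ⟨
  + (a * b) / (suc m * suc n)                  ∎
  where open ≡-Reasoning

n/n≡1 : ∀ n → + suc n / suc n ≡ 1ℚ
n/n≡1 n = fromℚᵘ-cong {mkℚᵘ (+ suc n) n} {ℚᵘ.1ℚᵘ} (ℚᵘ.*≡* (ℤ.*-comm (+ suc n) (+ 1)))

fromℕ : ℕ → ℚ
fromℕ n = + n / 1

fromℕ-homo-+ : ∀ m n → fromℕ (m + n) ≡ fromℕ m ℚ.+ fromℕ n
fromℕ-homo-+ m n = /-distribʳ-+ m n 0

fromℕ-homo-* : ∀ m n → fromℕ (m * n) ≡ fromℕ m ℚ.* fromℕ n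
fromℕ-homo-* m n = sym (/-*-interchange m n 0 0)

p-q<p : ∀ p {q} → 0ℚ ℚ.< q → p ℚ.- q ℚ.< p
p-q<p p q>0 = subst (p ℚ.- _ ℚ.<_) (ℚ.+-identityʳ p) (ℚ.+-monoʳ-< p (ℚ.neg-antimono-< q>0))

αRatio : ℕ → ℚ
αRatio j = + α (suc j) / suc j

S : ℕ → ℚ
S zero    = 0ℚ
S (suc m) = S m ℚ.+ αRatio m

term-suc : ∀ {n m} → m ≤ n → term (suc n) m ≡ αRatio m ℚ.+ term n m
term-suc {n} {m} m≤n = begin
  + ((suc n ∸ m) * α (suc m)) / suc m           ≡⟨ cong (λ x → + (x * α (suc m)) / suc m) (+-∸-assoc 1 m≤n) ⟩
  + (α (suc m) + (n ∸ m) * α (suc m)) / suc m   ≡⟨ /-distribʳ-+ (α (suc m)) ((n ∸ m) * α (suc m)) m ⟩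
  αRatio m ℚ.+ term n m                         ∎
  where open ≡-Reasoning

sumTo-suc : ∀ {n} m → m ≤ n → sumTo (suc n) m ≡ sumTo n m ℚ.+ S m
sumTo-suc zero    _   = refl
sumTo-suc {n} (suc m) m<n = begin
  sumTo (suc n) m ℚ.+ term (suc n) m
    ≡⟨ cong₂ ℚ._+_ (sumTo-suc m (<⇒≤ m<n)) (term-suc (<⇒≤ m<n)) ⟩
  (sumTo n m ℚ.+ S m) ℚ.+ (αRatio m ℚ.+ term n m)
    ≡⟨ solve 4 (λ a s w t → (a :+ s) :+ (w :+ t) := (a :+ t) :+ (s :+ w))
               refl (sumTo n m) (S m) (αRatio m) (term n m) ⟩
  (sumTo n m ℚ.+ term n m) ℚ.+ (S m ℚ.+ αRatio m)
    ∎
  where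
  open ≡-Reasoning
  open +-*-Solver

G-suc : ∀ n → G (suc n) ≡ G n ℚ.+ S (suc n)
G-suc n = begin
  sumTo (suc n) n ℚ.+ term (suc n) n  ≡⟨ cong₂ ℚ._+_ (sumTo-suc n ≤-refl) last-term ⟩
  (G n ℚ.+ S n) ℚ.+ αRatio n          ≡⟨ ℚ.+-assoc (G n) (S n) (αRatio n) ⟩
  G n ℚ.+ S (suc n)                   ∎
  where
  open ≡-Reasoning
  last-term : term (suc n) n ≡ αRatio n
  last-term = cong (λ x → + x / suc n)
                   (trans (cong (_* α (suc n)) (m+n∸n≡m 1 n)) (*-identityˡ (α (suc n))))

αRatio-odd : ∀ m → αRatio (2 * m) ≡ 1ℚ
αRatio-odd m = trans (cong (λ x → + x / suc (2 * m)) (α-odd m)) (n/n≡1 (2 * m))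

αRatio-even : ∀ m → αRatio (suc (2 * m)) ≡ ½ ℚ.* αRatio m
αRatio-even m = begin
  + α (2 + 2 * m) / (2 + 2 * m)    ≡⟨ ℚ./-cong (cong +_ α[2+2m]≡1*α[1+m]) (sym (*-suc 2 m)) ⟩
  + (1 * α (suc m)) / (2 * suc m)  ≡⟨ /-*-interchange 1 (α (suc m)) 1 m ⟨
  ½ ℚ.* αRatio m                   ∎
  where
  open ≡-Reasoning
  α[2+2m]≡1*α[1+m] : α (2 + 2 * m) ≡ 1 * α (suc m)
  α[2+2m]≡1*α[1+m] = trans (cong α (sym (*-suc 2 m))) (trans (α-double m) (sym (*-identityˡ (α (suc m)))))

S-double : ∀ m → S (2 * m) ≡ fromℕ m ℚ.+ ½ ℚ.* S m
S-double zero    = refl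
S-double (suc m) = begin
  S (2 * suc m)
    ≡⟨ cong S (*-suc 2 m) ⟩
  (S (2 * m) ℚ.+ αRatio (2 * m)) ℚ.+ αRatio (suc (2 * m))
    ≡⟨ cong₂ ℚ._+_ (cong₂ ℚ._+_ (S-double m) (αRatio-odd m)) (αRatio-even m) ⟩
  ((fromℕ m ℚ.+ ½ ℚ.* S m) ℚ.+ 1ℚ) ℚ.+ ½ ℚ.* αRatio m
    ≡⟨ solve 3 (λ x s w → ((x :+ con ½ :* s) :+ con 1ℚ) :+ con ½ :* w
                          := (con 1ℚ :+ x) :+ con ½ :* (s :+ w))
               refl (fromℕ m) (S m) (αRatio m) ⟩
  (1ℚ ℚ.+ fromℕ m) ℚ.+ ½ ℚ.* S (suc m)
    ≡⟨ cong (ℚ._+ ½ ℚ.* S (suc m)) (fromℕ-homo-+ 1 m) ⟨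
  fromℕ (suc m) ℚ.+ ½ ℚ.* S (suc m)
    ∎
  where
  open ≡-Reasoning
  open +-*-Solver

U : ℕ → ℚ
U m = fromℕ 3 ℚ.* S m ℚ.- fromℕ 2 ℚ.* fromℕ m

U-double : ∀ m → U (2 * m) ≡ ½ ℚ.* U m
U-double m = begin
  fromℕ 3 ℚ.* S (2 * m) ℚ.- fromℕ 2 ℚ.* fromℕ (2 * m)
    ≡⟨ cong₂ (λ s x → fromℕ 3 ℚ.* s ℚ.- fromℕ 2 ℚ.* x) (S-double m) (fromℕ-homo-* 2 m) ⟩
  fromℕ 3 ℚ.* (fromℕ m ℚ.+ ½ ℚ.* S m) ℚ.- fromℕ 2 ℚ.* (fromℕ 2 ℚ.* fromℕ m)
    ≡⟨ solve 2 (λ x s → con (fromℕ 3) :* (x :+ con ½ :* s) :- con (fromℕ 2) :* (con (fromℕ 2) :* x)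
                        := con ½ :* (con (fromℕ 3) :* s :- con (fromℕ 2) :* x))
               refl (fromℕ m) (S m) ⟩
  ½ ℚ.* U m
    ∎
  where
  open ≡-Reasoning
  open +-*-Solver

U-double-suc : ∀ m → U (suc (2 * m)) ≡ 1ℚ ℚ.+ ½ ℚ.* U m
U-double-suc m = begin
  fromℕ 3 ℚ.* (S (2 * m) ℚ.+ αRatio (2 * m)) ℚ.- fromℕ 2 ℚ.* fromℕ (1 + 2 * m)
    ≡⟨ cong₂ (λ s x → fromℕ 3 ℚ.* s ℚ.- fromℕ 2 ℚ.* x)
             (cong₂ ℚ._+_ (S-double m) (αRatio-odd m)) fromℕ[1+2m] ⟩
  fromℕ 3 ℚ.* ((fromℕ m ℚ.+ ½ ℚ.* S m) ℚ.+ 1ℚ) ℚ.- fromℕ 2 ℚ.* (1ℚ ℚ.+ fromℕ 2 ℚ.* fromℕ m)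
    ≡⟨ solve 2 (λ x s → con (fromℕ 3) :* ((x :+ con ½ :* s) :+ con 1ℚ)
                          :- con (fromℕ 2) :* (con 1ℚ :+ con (fromℕ 2) :* x)
                        := con 1ℚ :+ con ½ :* (con (fromℕ 3) :* s :- con (fromℕ 2) :* x))
               refl (fromℕ m) (S m) ⟩
  1ℚ ℚ.+ ½ ℚ.* U m
    ∎
  where
  open ≡-Reasoning
  open +-*-Solver
  fromℕ[1+2m] : fromℕ (1 + 2 * m) ≡ 1ℚ ℚ.+ fromℕ 2 ℚ.* fromℕ m
  fromℕ[1+2m] = trans (fromℕ-homo-+ 1 (2 * m)) (cong (1ℚ ℚ.+_) (fromℕ-homo-* 2 m))

T : ℕ → ℚ
T zero    = 0ℚ
T (suc n) = T n ℚ.+ (U (suc n) ℚ.- 1ℚ)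

3*G≡n[n+2]+T : ∀ n → fromℕ 3 ℚ.* G n ≡ fromℕ n ℚ.* (fromℕ n ℚ.+ fromℕ 2) ℚ.+ T n
3*G≡n[n+2]+T zero    = refl
3*G≡n[n+2]+T (suc n) = begin
  fromℕ 3 ℚ.* G (suc n)
    ≡⟨ cong (fromℕ 3 ℚ.*_) (G-suc n) ⟩
  fromℕ 3 ℚ.* (G n ℚ.+ S (suc n))
    ≡⟨ ℚ.*-distribˡ-+ (fromℕ 3) (G n) (S (suc n)) ⟩
  fromℕ 3 ℚ.* G n ℚ.+ fromℕ 3 ℚ.* S (suc n)
    ≡⟨ cong (ℚ._+ fromℕ 3 ℚ.* S (suc n)) (3*G≡n[n+2]+T n) ⟩
  (x ℚ.* (x ℚ.+ fromℕ 2) ℚ.+ T n) ℚ.+ fromℕ 3 ℚ.* S (suc n)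
    ≡⟨ solve 3 (λ x t s → (x :* (x :+ con (fromℕ 2)) :+ t) :+ con (fromℕ 3) :* s
                          := (con 1ℚ :+ x) :* ((con 1ℚ :+ x) :+ con (fromℕ 2))
                             :+ (t :+ ((con (fromℕ 3) :* s :- con (fromℕ 2) :* (con 1ℚ :+ x)) :- con 1ℚ)))
               refl x (T n) (S (suc n)) ⟩
  y ℚ.* (y ℚ.+ fromℕ 2) ℚ.+ (T n ℚ.+ (fromℕ 3 ℚ.* S (suc n) ℚ.- fromℕ 2 ℚ.* y ℚ.- 1ℚ))
    ≡⟨ cong (λ z → z ℚ.* (z ℚ.+ fromℕ 2) ℚ.+ (T n ℚ.+ (fromℕ 3 ℚ.* S (suc n) ℚ.- fromℕ 2 ℚ.* z ℚ.- 1ℚ)))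
            (fromℕ-homo-+ 1 n) ⟨
  fromℕ (suc n) ℚ.* (fromℕ (suc n) ℚ.+ fromℕ 2) ℚ.+ T (suc n)
    ∎
  where
  open ≡-Reasoning
  open +-*-Solver
  x y : ℚ
  x = fromℕ n
  y = 1ℚ ℚ.+ fromℕ n

mutual
  T-odd : ∀ n → T (suc (2 * n)) ≡ T n
  T-odd zero    = refl
  T-odd (suc n) = begin
    T (2 * suc n) ℚ.+ (U (suc (2 * suc n)) ℚ.- 1ℚ)
      ≡⟨ cong₂ (λ t v → t ℚ.+ (v ℚ.- 1ℚ)) (T-even n) (U-double-suc (suc n)) ⟩
    (T (suc n) ℚ.- ½ ℚ.* u) ℚ.+ ((1ℚ ℚ.+ ½ ℚ.* u) ℚ.- 1ℚ)
      ≡⟨ solve 2 (λ t u → (t :- con ½ :* u) :+ ((con 1ℚ :+ con ½ :* u) :- con 1ℚ) := t) refl (T (suc n)) u ⟩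
    T (suc n)
      ∎
    where
    open ≡-Reasoning
    open +-*-Solver
    u : ℚ
    u = U (suc n)

  T-even : ∀ n → T (2 * suc n) ≡ T (suc n) ℚ.- ½ ℚ.* U (suc n)
  T-even n = begin
    T (2 * suc n)
      ≡⟨ cong T (*-suc 2 n) ⟩
    T (suc (2 * n)) ℚ.+ (U (2 + 2 * n) ℚ.- 1ℚ)
      ≡⟨ cong₂ (λ t v → t ℚ.+ (v ℚ.- 1ℚ)) (T-odd n) U[2+2n]≡½u ⟩
    T n ℚ.+ (½ ℚ.* u ℚ.- 1ℚ)
      ≡⟨ solve 2 (λ t u → t :+ (con ½ :* u :- con 1ℚ) := (t :+ (u :- con 1ℚ)) :- con ½ :* u) refl (T n) u ⟩
    T (suc n) ℚ.- ½ ℚ.* u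
      ∎
    where
    open ≡-Reasoning
    open +-*-Solver
    u : ℚ
    u = U (suc n)
    U[2+2n]≡½u : U (2 + 2 * n) ≡ ½ ℚ.* u
    U[2+2n]≡½u = trans (cong U (sym (*-suc 2 n))) (U-double (suc n))

U-pos : ∀ n → 0 < n → 0ℚ ℚ.< U n
U-pos = binary-induction (λ n → 0 < n → 0ℚ ℚ.< U n) (λ ())
  (λ k U-pos-k _ → subst (0ℚ ℚ.<_) (sym (U-double-suc k))
                     (ℚ.+-mono-<-≤ (ℚ.positive⁻¹ 1ℚ) (ℚ.*-monoˡ-≤-nonNeg ½ (U-nonneg k U-pos-k))))
  (λ k U-pos-sk _ → subst (0ℚ ℚ.<_) (sym (U-double (suc k))) (ℚ.*-monoʳ-<-pos ½ (U-pos-sk z<s)))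
  where
  U-nonneg : ∀ k → (0 < k → 0ℚ ℚ.< U k) → 0ℚ ℚ.≤ U k
  U-nonneg zero    _       = ℚ.≤-refl
  U-nonneg (suc k) U-pos-k = ℚ.<⇒≤ (U-pos-k z<s)

T-even<T : ∀ n → T (2 * suc n) ℚ.< T (suc n)
T-even<T n = subst (ℚ._< T (suc n)) (sym (T-even n))
                   (p-q<p (T (suc n)) (ℚ.*-monoʳ-<-pos ½ (U-pos (suc n) z<s)))

T-nonpos : ∀ n → T n ℚ.≤ 0ℚ
T-nonpos = binary-induction (λ n → T n ℚ.≤ 0ℚ) ℚ.≤-refl
  (λ k T≤0 → subst (ℚ._≤ 0ℚ) (sym (T-odd k)) T≤0)
  (λ k T≤0 → ℚ.<⇒≤ (ℚ.<-≤-trans (T-even<T k) T≤0))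

T≡0⇒Mersenne : ∀ n → T n ≡ 0ℚ → Mersenne n
T≡0⇒Mersenne = binary-induction (λ n → T n ≡ 0ℚ → Mersenne n) (λ _ → 0 , refl) odd-case even-case
  where
  odd-case : ∀ k → (T k ≡ 0ℚ → Mersenne k) → T (suc (2 * k)) ≡ 0ℚ → Mersenne (suc (2 * k))
  odd-case k ih T≡0 with ih (trans (sym (T-odd k)) T≡0)
  ... | r , k≡2^r∸1 = suc r , trans (cong (λ x → suc (2 * x)) k≡2^r∸1) (sym (2^r∸1-suc r))
  even-case : ∀ k → (T (suc k) ≡ 0ℚ → Mersenne (suc k)) → T (2 * suc k) ≡ 0ℚ → Mersenne (2 * suc k)
  even-case k _ T≡0 = ⊥-elim (ℚ.<-irrefl T≡0 (ℚ.<-≤-trans (T-even<T k) (T-nonpos (suc k))))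

T[2^r∸1]≡0 : ∀ r → T (2 ^ r ∸ 1) ≡ 0ℚ
T[2^r∸1]≡0 zero    = refl
T[2^r∸1]≡0 (suc r) = trans (cong T (2^r∸1-suc r)) (trans (T-odd (2 ^ r ∸ 1)) (T[2^r∸1]≡0 r))

G≡n[n+2]/3⇔T≡0 : ∀ n → G n ≡ + (n * (n + 2)) / 3 ⇔ T n ≡ 0ℚ
G≡n[n+2]/3⇔T≡0 n = mk⇔ to from
  where
  open ≡-Reasoning
  open +-*-Solver
  ⅓ A : ℚ
  ⅓ = + 1 / 3
  A = fromℕ n ℚ.* (fromℕ n ℚ.+ fromℕ 2)
  n[n+2]/3≡⅓A : + (n * (n + 2)) / 3 ≡ ⅓ ℚ.* A
  n[n+2]/3≡⅓A = begin
    + (n * (n + 2)) / 3                ≡⟨ cong (λ x → + x / 3) (*-identityˡ (n * (n + 2))) ⟨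
    + (1 * (n * (n + 2))) / 3          ≡⟨ /-*-interchange 1 (n * (n + 2)) 2 0 ⟨
    ⅓ ℚ.* fromℕ (n * (n + 2))          ≡⟨ cong (⅓ ℚ.*_) (fromℕ-homo-* n (n + 2)) ⟩
    ⅓ ℚ.* (fromℕ n ℚ.* fromℕ (n + 2))  ≡⟨ cong (λ z → ⅓ ℚ.* (fromℕ n ℚ.* z)) (fromℕ-homo-+ n 2) ⟩
    ⅓ ℚ.* A                            ∎
  to : G n ≡ + (n * (n + 2)) / 3 → T n ≡ 0ℚ
  to G≡ = begin
    T n                          ≡⟨ solve 2 (λ a t → t := (a :+ t) :- a) refl A (T n) ⟩
    (A ℚ.+ T n) ℚ.- A            ≡⟨ cong (ℚ._- A) (3*G≡n[n+2]+T n) ⟨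
    fromℕ 3 ℚ.* G n ℚ.- A        ≡⟨ cong (λ g → fromℕ 3 ℚ.* g ℚ.- A) (trans G≡ n[n+2]/3≡⅓A) ⟩
    fromℕ 3 ℚ.* (⅓ ℚ.* A) ℚ.- A  ≡⟨ solve 1 (λ a → con (fromℕ 3) :* (con ⅓ :* a) :- a := con 0ℚ) refl A ⟩
    0ℚ                           ∎
  from : T n ≡ 0ℚ → G n ≡ + (n * (n + 2)) / 3
  from T≡0 = begin
    G n                      ≡⟨ solve 1 (λ g → g := con ⅓ :* (con (fromℕ 3) :* g)) refl (G n) ⟩
    ⅓ ℚ.* (fromℕ 3 ℚ.* G n)  ≡⟨ cong (⅓ ℚ.*_) (trans (3*G≡n[n+2]+T n) (cong (A ℚ.+_) T≡0)) ⟩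
    ⅓ ℚ.* (A ℚ.+ 0ℚ)         ≡⟨ cong (⅓ ℚ.*_) (ℚ.+-identityʳ A) ⟩
    ⅓ ℚ.* A                  ≡⟨ n[n+2]/3≡⅓A ⟨
    + (n * (n + 2)) / 3      ∎

corollary5 : (n : ℕ) → 1 ≤ n →
    (G n ≡ (+ (n * (n + 2))) / 3) ⇔ Σ ℕ (λ r → 1 ≤ r × n ≡ 2 ^ r ∸ 1)
corollary5 n 1≤n = mk⇔
  (λ G≡ → positive-exponent (T≡0⇒Mersenne n (Equivalence.to (G≡n[n+2]/3⇔T≡0 n) G≡)))
  (λ { (r , _ , n≡2^r∸1) → Equivalence.from (G≡n[n+2]/3⇔T≡0 n) (trans (cong T n≡2^r∸1) (T[2^r∸1]≡0 r)) })
  where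
  positive-exponent : Mersenne n → Σ ℕ (λ r → 1 ≤ r × n ≡ 2 ^ r ∸ 1)
  positive-exponent (zero  , n≡0)       = ⊥-elim (<⇒≢ 1≤n (sym n≡0))
  positive-exponent (suc r , n≡2^r∸1) = suc r , s≤s z≤n , n≡2^r∸1
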